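{- Let $\mathcal{G}$ be a finite partial Sherk plane in which some line is incident only with thick points. Let $b$ be the number of lines of $\mathcal{G}$, let $n$ be the (constant) number of points on each line and $r$ the (constant) number of lines through each point. Then every point of $\mathcal{G}$ has exactly $(nr-b)/(r-1)$ polars.
   Context: A partial Sherk plane is a structure of points, lines, an incidence relation, and a binary relation $\perp$ on lines satisfying: (A*) two distinct points lie on at most one line; (B1) $\ell\perp m$ implies $m\perp\ell$; (B2) perpendicular lines intersect in at least one point; (B3) for any point $P$ and line $\ell$ there is at least one line through $P$ perpendicular to $\ell$; (B4) for any line $\ell$ and point $P$ on $\ell$ there is a unique line through $P$ perpendicular to $\ell$; (B5) there exist lines $x,y,z$ with $x\perp y$, $x\not\perp z$, $y\not\perp z$, and $x,y,z$ not all through a common point. Finite means finitely many points. A point is thick if it lies on at least three lines. Under the hypotheses, all lines have the same number $n$ of points and all points lie on the same number $r$ of lines. A line $\ell$ is a polar of a point $P$ if $P$ is not on $\ell$ and more than one line through $P$ is perpendicular to $\ell$. -}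

module Defs where

open import Data.Nat using (ℕ; zero; suc; _+_; _≤_)
open import Data.Fin using (Fin; zero; suc)
open import Data.Bool using (Bool; true; false; _∧_; not; if_then_else_)
open import Data.Product using (Σ; ∃; _×_; _,_)
open import Relation.Binary.PropositionalEquality using (_≡_; _≢_)
open import Relation.Nullary using (¬_)

count : ∀ {k} → (Fin k → Bool) → ℕ
count {zero}  f = 0
count {suc k} f = (if f zero then 1 else 0) + count (λ i → f (suc i))

-- A finite incidence structure with a perpendicularity relation:
-- v points (Fin v), b lines (Fin b), incidence I P ℓ, perpendicularity ℓ ⊥ m
-- (both Bool-valued, hence decidable, as befits a finite structure).
record Structure (v b : ℕ) : Set where
  field
    I   : Fin v → Fin b → Bool
    _⊥_ : Fin b → Fin b → Bool

module _ {v b : ℕ} (G : Structure v b) where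
  open Structure G

  AxA : Set
  AxA = ∀ (P Q : Fin v) (ℓ m : Fin b) → P ≢ Q →
        I P ℓ ≡ true → I Q ℓ ≡ true → I P m ≡ true → I Q m ≡ true → ℓ ≡ m

  AxB1 : Set
  AxB1 = ∀ (ℓ m : Fin b) → (ℓ ⊥ m) ≡ true → (m ⊥ ℓ) ≡ true

  AxB2 : Set
  AxB2 = ∀ (ℓ m : Fin b) → (ℓ ⊥ m) ≡ true →
         Σ (Fin v) λ P → I P ℓ ≡ true × I P m ≡ true

  AxB3 : Set
  AxB3 = ∀ (P : Fin v) (ℓ : Fin b) →
         Σ (Fin b) λ m → I P m ≡ true × (m ⊥ ℓ) ≡ true

  AxB4 : Set
  AxB4 = ∀ (ℓ : Fin b) (P : Fin v) → I P ℓ ≡ true →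
         Σ (Fin b) (λ m → I P m ≡ true × (m ⊥ ℓ) ≡ true) ×
         (∀ (m m′ : Fin b) → I P m ≡ true → (m ⊥ ℓ) ≡ true →
                              I P m′ ≡ true → (m′ ⊥ ℓ) ≡ true → m ≡ m′)

  AxB5 : Set
  AxB5 = Σ (Fin b) λ x → Σ (Fin b) λ y → Σ (Fin b) λ z →
         (x ⊥ y) ≡ true × (x ⊥ z) ≡ false × (y ⊥ z) ≡ false ×
         ¬ (Σ (Fin v) λ P → I P x ≡ true × I P y ≡ true × I P z ≡ true)

  record IsPartialSherkPlane : Set where
    field
      axA  : AxA
      axB1 : AxB1
      axB2 : AxB2
      axB3 : AxB3
      axB4 : AxB4
      axB5 : AxB5

  pointsOn : Fin b → ℕ
  pointsOn ℓ = count (λ P → I P ℓ)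

  linesThrough : Fin v → ℕ
  linesThrough P = count (λ ℓ → I P ℓ)

  Thick : Fin v → Set
  Thick P = 3 ≤ linesThrough P

  perpsThrough : Fin v → Fin b → ℕ
  perpsThrough P ℓ = count (λ m → I P m ∧ (m ⊥ ℓ))

  IsPolar : Fin v → Fin b → Set
  IsPolar P ℓ = I P ℓ ≡ false × 2 ≤ perpsThrough P ℓ

  isPolar? : Fin v → Fin b → Bool
  isPolar? P ℓ = not (I P ℓ) ∧ leq2 (perpsThrough P ℓ)
    where
    leq2 : ℕ → Bool
    leq2 (suc (suc _)) = true
    leq2 _             = false

  numPolars : Fin v → ℕ
  numPolars P = count (λ ℓ → isPolar? P ℓ)

module Submission where

-- Fix a point P and double count the pairs (m , ℓ) of lines with P on m
-- and m ⊥ ℓ.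
--  * Grouped by m: a line m that is not perpendicular to itself has
--    exactly as many perpendiculars as points (B2 and B4 match each
--    perpendicular with the point where it meets m), and under uniform
--    line size no line is self-perpendicular (by B5); so the count is n·r.
--  * Grouped by ℓ: the number of lines through P perpendicular to ℓ is 1
--    if P lies on ℓ (B4), and otherwise is 1, or — when ℓ is a polar of P —
--    all r lines through P: if two lines through P are perpendicular to ℓ,
--    a third line m through P that is not, would have its n points sent
--    injectively into the n perpendiculars of ℓ while missing one of them.
--    So the count is b + (number of polars)·(r − 1).

open import Defs
open import Data.Nat using (ℕ; zero; suc; _+_; _*_; _∸_; _≤_; _<_; z≤n; s≤s; s≤s⁻¹)
open import Data.Nat.Properties
  using (≤-trans; n≤1+n; ≤-antisym; ≮⇒≥; n≮n; +-suc; +-comm; *-suc; *-comm; *-zeroʳ; *-identityˡ; m+[n∸m]≡n; +-*-semiring)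
  renaming (suc-injective to ℕ-suc-injective)
open import Data.Fin using (Fin; zero; suc; _≟_)
open import Data.Fin.Properties using () renaming (suc-injective to Fin-suc-injective)
open import Data.Bool using (Bool; true; false; _∧_; not; if_then_else_)
open import Data.Product using (Σ; _×_; _,_; proj₁; proj₂)
open import Function using (_∘_)
open import Relation.Nullary using (¬_; yes; no; does; contradiction)
open import Relation.Nullary.Decidable using (dec-false)
open import Relation.Binary.PropositionalEquality
open import Algebra.Properties.Semiring.Sum +-*-semiring
  using (sum; sum-cong-≗; ∑-comm; ∑-distrib-+; *-distribʳ-sum)

indicator : Bool → ℕ
indicator x = if x then 1 else 0

-- A count is a sum of indicators; this gives access to the library's
-- lemmas on finite sums.
count-as-sum : ∀ {k} (f : Fin k → Bool) → count f ≡ sum (indicator ∘ f)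
count-as-sum {zero}  f = refl
count-as-sum {suc k} f = cong (indicator (f zero) +_) (count-as-sum (f ∘ suc))

count-cong : ∀ {k} {f g : Fin k → Bool} → (∀ i → f i ≡ g i) → count f ≡ count g
count-cong {f = f} {g} f≗g = begin
  count f                ≡⟨ count-as-sum f ⟩
  sum (indicator ∘ f)    ≡⟨ sum-cong-≗ (cong indicator ∘ f≗g) ⟩
  sum (indicator ∘ g)    ≡⟨ count-as-sum g ⟨
  count g                ∎
  where open ≡-Reasoning

count-const : ∀ k x → count {k} (λ _ → x) ≡ indicator x * k
count-const zero    x = sym (*-zeroʳ (indicator x))
count-const (suc k) x = trans (cong (indicator x +_) (count-const k x)) (sym (*-suc (indicator x) k))

count-≤ : ∀ {k} (f : Fin k → Bool) → count f ≤ k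
count-≤ {zero}  f = z≤n
count-≤ {suc k} f with f zero
... | true  = s≤s (count-≤ (f ∘ suc))
... | false = ≤-trans (count-≤ (f ∘ suc)) (n≤1+n k)

count-full : ∀ {k} (f : Fin k → Bool) → count f ≡ k → ∀ i → f i ≡ true
count-full {suc k} f full i with f zero in f₀
... | false = contradiction (subst (_≤ k) full (count-≤ (f ∘ suc))) (n≮n k)
... | true  = at i
  where
  at : ∀ i → f i ≡ true
  at zero    = f₀
  at (suc i) = count-full (f ∘ suc) (ℕ-suc-injective full) i

count-witness : ∀ {k} (f : Fin k → Bool) → 1 ≤ count f → Σ (Fin k) λ i → f i ≡ true
count-witness {suc k} f pos with f zero in f₀
... | true  = zero , f₀
... | false with count-witness (f ∘ suc) pos
...   | i , fi = suc i , fi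

_without_ : ∀ {k} → (Fin k → Bool) → Fin k → Fin k → Bool
(g without j) i = not (does (i ≟ j)) ∧ g i

without-keeps : ∀ {k} (g : Fin k → Bool) {i j} → g i ≡ true → i ≢ j → (g without j) i ≡ true
without-keeps g {i} {j} gi i≢j rewrite dec-false (i ≟ j) i≢j = gi

without-sound : ∀ {k} (g : Fin k → Bool) i j → (g without j) i ≡ true → g i ≡ true × i ≢ j
without-sound g i j gi with i ≟ j
... | no i≢j = gi , i≢j

count-remove : ∀ {k} (g : Fin k → Bool) (j : Fin k) → g j ≡ true →
               count g ≡ suc (count (g without j))
count-remove {suc k} g zero    gj rewrite gj = refl
count-remove {suc k} g (suc j) gj rewrite count-remove (g ∘ suc) j gj =
  +-suc (indicator (g zero)) _

count-positive : ∀ {k} (f : Fin k → Bool) (i : Fin k) → f i ≡ true → 1 ≤ count f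
count-positive f i fi = subst (1 ≤_) (sym (count-remove f i fi)) (s≤s z≤n)

count-two : ∀ {k} (f : Fin k → Bool) → 2 ≤ count f →
            Σ (Fin k) λ i → Σ (Fin k) λ j → i ≢ j × f i ≡ true × f j ≡ true
count-two f two with count-witness f (≤-trans (s≤s z≤n) two)
... | i , fi with count-witness (f without i) (s≤s⁻¹ (subst (2 ≤_) (count-remove f i fi) two))
...   | j , fj with without-sound f j i fj
...     | fj′ , j≢i = j , i , j≢i , fj′ , fi

record _↪_ {a c} (f : Fin a → Bool) (g : Fin c → Bool) : Set where
  field
    to        : ∀ i → f i ≡ true → Fin c
    to-into   : ∀ i p → g (to i p) ≡ true
    injective : ∀ i j p q → to i p ≡ to j q → i ≡ j
open _↪_

↪-tail : ∀ {a c} {f : Fin (suc a) → Bool} {g : Fin c → Bool} → f ↪ g → (f ∘ suc) ↪ g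
↪-tail φ = record
  { to        = λ i → to φ (suc i)
  ; to-into   = λ i → to-into φ (suc i)
  ; injective = λ i j p q eq → Fin-suc-injective (injective φ (suc i) (suc j) p q eq)
  }

↪-avoiding : ∀ {a c} {f : Fin a → Bool} {g : Fin c → Bool} (φ : f ↪ g) (e : Fin c) →
             (∀ i p → to φ i p ≢ e) → f ↪ (g without e)
↪-avoiding {g = g} φ e misses = record
  { to        = to φ
  ; to-into   = λ i p → without-keeps g (to-into φ i p) (misses i p)
  ; injective = injective φ
  }

count-mono        : ∀ {a c} {f : Fin a → Bool} {g : Fin c → Bool} → f ↪ g → count f ≤ count g
count-mono-strict : ∀ {a c} {f : Fin a → Bool} {g : Fin c → Bool} (φ : f ↪ g) (e : Fin c) →
                    g e ≡ true → (∀ i p → to φ i p ≢ e) → count f < count g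

count-mono {zero}          φ = z≤n
count-mono {suc a} {f = f} φ with f zero in f₀
... | false = count-mono (↪-tail φ)
... | true  = count-mono-strict (↪-tail φ) (to φ zero f₀) (to-into φ zero f₀) first-missed
  where
  first-missed : ∀ i p → to φ (suc i) p ≢ to φ zero f₀
  first-missed i p eq with injective φ (suc i) zero p f₀ eq
  ... | ()

count-mono-strict {g = g} φ e ge misses =
  subst (_ <_) (sym (count-remove g e ge)) (s≤s (count-mono (↪-avoiding φ e misses)))

sum-indicator-scaled : ∀ {k} (f : Fin k → Bool) (c : ℕ) →
                       sum (λ i → indicator (f i) * c) ≡ count f * c
sum-indicator-scaled f c = begin
  sum (λ i → indicator (f i) * c) ≡⟨ *-distribʳ-sum c (indicator ∘ f) ⟨
  sum (indicator ∘ f) * c         ≡⟨ cong (_* c) (count-as-sum f) ⟨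
  count f * c                     ∎
  where open ≡-Reasoning

count-∧ˡ : ∀ {k} x (R : Fin k → Bool) → count (λ j → x ∧ R j) ≡ indicator x * count R
count-∧ˡ {k} false R = count-const k false
count-∧ˡ     true  R = sym (*-identityˡ (count R))

double-count : ∀ {a c} (f : Fin a → Bool) (R : Fin a → Fin c → Bool) →
               sum (λ j → count (λ i → f i ∧ R i j)) ≡ sum (λ i → indicator (f i) * count (R i))
double-count f R = begin
  sum (λ j → count (λ i → f i ∧ R i j))                   ≡⟨ sum-cong-≗ (λ j → count-as-sum (λ i → f i ∧ R i j)) ⟩
  sum (λ j → sum (λ i → indicator (f i ∧ R i j)))         ≡⟨ ∑-comm (λ j i → indicator (f i ∧ R i j)) ⟩
  sum (λ i → sum (λ j → indicator (f i ∧ R i j)))         ≡⟨ sum-cong-≗ (λ i → count-as-sum (λ j → f i ∧ R i j)) ⟨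
  sum (λ i → count (λ j → f i ∧ R i j))                   ≡⟨ sum-cong-≗ (λ i → count-∧ˡ (f i) (R i)) ⟩
  sum (λ i → indicator (f i) * count (R i))               ∎
  where open ≡-Reasoning

sum-one-plus-scaled : ∀ {k} (f : Fin k → Bool) (c : ℕ) →
                      sum (λ i → 1 + indicator (f i) * c) ≡ k + count f * c
sum-one-plus-scaled {k} f c = begin
  sum (λ i → 1 + indicator (f i) * c)                 ≡⟨ ∑-distrib-+ (λ _ → 1) (λ i → indicator (f i) * c) ⟩
  sum {k} (λ _ → 1) + sum (λ i → indicator (f i) * c) ≡⟨ cong₂ _+_ ones (sum-indicator-scaled f c) ⟩
  k + count f * c                                     ∎
  where
  open ≡-Reasoning
  ones : sum {k} (λ _ → 1) ≡ k
  ones = trans (sym (count-as-sum {k} (λ _ → true))) (trans (count-const k true) (*-identityˡ k))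

∧-split : ∀ {x y} → x ∧ y ≡ true → x ≡ true × y ≡ true
∧-split {true} y = refl , y

∧-intro : ∀ {x y} → x ≡ true → y ≡ true → x ∧ y ≡ true
∧-intro refl y = y

module PartialSherkPlane {v b : ℕ} (G : Structure v b) (S : IsPartialSherkPlane G) where
  open Structure G
  open IsPartialSherkPlane S

  ⊥-comm : ∀ l m → (l ⊥ m) ≡ (m ⊥ l)
  ⊥-comm l m with l ⊥ m in lm | m ⊥ l in ml
  ... | true  | true  = refl
  ... | false | false = refl
  ... | true  | false = trans (sym (axB1 l m lm)) ml
  ... | false | true  = trans (sym lm) (axB1 m l ml)

  -- A perpendicular to m meets m (B2) in a point at which it is the only
  -- perpendicular to m (B4); so perpendiculars of m inject into its points.
  perpendiculars↪points : ∀ m → (λ l → l ⊥ m) ↪ (λ Q → I Q m)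
  perpendiculars↪points m = record
    { to        = foot
    ; to-into   = foot-on-m
    ; injective = λ l l′ p q eq →
        proj₂ (axB4 m (foot l p) (foot-on-m l p)) l l′ (foot-on-l l p) p
          (subst (λ Q → I Q l′ ≡ true) (sym eq) (foot-on-l l′ q)) q
    }
    where
    foot : ∀ l → (l ⊥ m) ≡ true → Fin v
    foot l p = proj₁ (axB2 l m p)
    foot-on-l : ∀ l p → I (foot l p) l ≡ true
    foot-on-l l p = proj₁ (proj₂ (axB2 l m p))
    foot-on-m : ∀ l p → I (foot l p) m ≡ true
    foot-on-m l p = proj₂ (proj₂ (axB2 l m p))

  -- By (A*) a line sharing two points with m is m; so a line perpendicular
  -- to ℓ meets a line not perpendicular to ℓ in at most one point.
  meets-at-most-once : ∀ {ℓ k m Y Y′} → (k ⊥ ℓ) ≡ true → (m ⊥ ℓ) ≡ false →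
                       I Y k ≡ true → I Y′ k ≡ true → I Y m ≡ true → I Y′ m ≡ true → Y ≡ Y′
  meets-at-most-once {ℓ} {k} {m} {Y} {Y′} k⊥ℓ m⊥̸ℓ Yk Y′k Ym Y′m with Y ≟ Y′
  ... | yes Y≡Y′ = Y≡Y′
  ... | no  Y≢Y′ = contradiction (trans (sym k⊥ℓ) (trans (cong (_⊥ ℓ) k≡m) m⊥̸ℓ)) λ ()
    where
    k≡m : k ≡ m
    k≡m = axA Y Y′ k m Y≢Y′ Yk Y′k Ym Y′m

  points↪perpendiculars : ∀ m → (m ⊥ m) ≡ false → (λ Q → I Q m) ↪ (λ l → l ⊥ m)
  points↪perpendiculars m m⊥̸m = record
    { to        = erect
    ; to-into   = erect-⊥
    ; injective = λ Q Q′ p q eq →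
        meets-at-most-once (erect-⊥ Q p) m⊥̸m (on-erect Q p)
          (subst (λ l → I Q′ l ≡ true) (sym eq) (on-erect Q′ q)) p q
    }
    where
    erect : ∀ Q → I Q m ≡ true → Fin b
    erect Q p = proj₁ (proj₁ (axB4 m Q p))
    on-erect : ∀ Q p → I Q (erect Q p) ≡ true
    on-erect Q p = proj₁ (proj₂ (proj₁ (axB4 m Q p)))
    erect-⊥ : ∀ Q p → (erect Q p ⊥ m) ≡ true
    erect-⊥ Q p = proj₂ (proj₂ (proj₁ (axB4 m Q p)))

  -- A self-perpendicular line m passes through every point Y: the
  -- perpendicular to m through Y (B3) meets m (B2) at a point where m is
  -- also perpendicular to m, so it is m (B4).
  self-perpendicular-covers : ∀ m → (m ⊥ m) ≡ true → ∀ Y → I Y m ≡ true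
  self-perpendicular-covers m m⊥m Y with axB3 Y m
  ... | t , Yt , t⊥m with axB2 t m t⊥m
  ...   | Q , Qt , Qm = subst (λ l → I Y l ≡ true) (proj₂ (axB4 m Q Qm) t m Qt t⊥m Qm m⊥m) Yt

  perpsThrough-positive : ∀ P ℓ → 1 ≤ perpsThrough G P ℓ
  perpsThrough-positive P ℓ with axB3 P ℓ
  ... | t , Pt , t⊥ℓ = count-positive (λ m → I P m ∧ (m ⊥ ℓ)) t (∧-intro Pt t⊥ℓ)

  perpsThrough-on : ∀ {P ℓ} → I P ℓ ≡ true → perpsThrough G P ℓ ≡ 1
  perpsThrough-on {P} {ℓ} Pℓ = ≤-antisym (≮⇒≥ at-most-one) (perpsThrough-positive P ℓ)
    where
    at-most-one : ¬ (2 ≤ perpsThrough G P ℓ)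
    at-most-one two with count-two (λ m → I P m ∧ (m ⊥ ℓ)) two
    ... | i , j , i≢j , Pi∧i⊥ℓ , Pj∧j⊥ℓ with ∧-split Pi∧i⊥ℓ | ∧-split Pj∧j⊥ℓ
    ...   | Pi , i⊥ℓ | Pj , j⊥ℓ = i≢j (proj₂ (axB4 ℓ P Pℓ) i j Pi i⊥ℓ Pj j⊥ℓ)

  perpTo : Fin b → Fin v → Fin b
  perpTo ℓ Y = proj₁ (axB3 Y ℓ)

  on-perpTo : ∀ ℓ Y → I Y (perpTo ℓ Y) ≡ true
  on-perpTo ℓ Y = proj₁ (proj₂ (axB3 Y ℓ))

  perpTo-⊥ : ∀ ℓ Y → (perpTo ℓ Y ⊥ ℓ) ≡ true
  perpTo-⊥ ℓ Y = proj₂ (proj₂ (axB3 Y ℓ))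

  -- Let m be a line not perpendicular to ℓ, P a point of m, and e a
  -- perpendicular to ℓ through P other than the chosen one.  Then m has
  -- fewer points than ℓ has perpendiculars: Y ↦ perpTo ℓ Y is injective on
  -- m and never hits e.
  fewer-points-than-perpendiculars :
    ∀ {P ℓ e m} → I P e ≡ true → (e ⊥ ℓ) ≡ true → e ≢ perpTo ℓ P →
    I P m ≡ true → (m ⊥ ℓ) ≡ false → pointsOn G m < count (λ l → l ⊥ ℓ)
  fewer-points-than-perpendiculars {P} {ℓ} {e} {m} Pe e⊥ℓ e≢perpP Pm m⊥̸ℓ =
    count-mono-strict choice e e⊥ℓ misses-e
    where
    choice : (λ Y → I Y m) ↪ (λ l → l ⊥ ℓ)
    choice = record
      { to        = λ Y _ → perpTo ℓ Y
      ; to-into   = λ Y _ → perpTo-⊥ ℓ Y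
      ; injective = λ Y Y′ Ym Y′m eq →
          meets-at-most-once (perpTo-⊥ ℓ Y) m⊥̸ℓ (on-perpTo ℓ Y)
            (subst (λ l → I Y′ l ≡ true) (sym eq) (on-perpTo ℓ Y′)) Ym Y′m
      }
    misses-e : ∀ Y Ym → perpTo ℓ Y ≢ e
    misses-e Y Ym eq = e≢perpP (trans (sym eq) (cong (perpTo ℓ) Y≡P))
      where
      Y≡P : Y ≡ P
      Y≡P = meets-at-most-once e⊥ℓ m⊥̸ℓ (subst (λ l → I Y l ≡ true) eq (on-perpTo ℓ Y)) Pe Ym Pm

  -- If two distinct perpendiculars to ℓ pass through a point P of a line m
  -- not perpendicular to ℓ, then m has fewer points than ℓ has
  -- perpendiculars, since one of the two is not the chosen one at P.
  pencil-bound : ∀ {P ℓ m₁ m₂ m} → m₁ ≢ m₂ →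
                 I P m₁ ≡ true → (m₁ ⊥ ℓ) ≡ true → I P m₂ ≡ true → (m₂ ⊥ ℓ) ≡ true →
                 I P m ≡ true → (m ⊥ ℓ) ≡ false → pointsOn G m < count (λ l → l ⊥ ℓ)
  pencil-bound {P} {ℓ} {m₁} m₁≢m₂ Pm₁ m₁⊥ℓ Pm₂ m₂⊥ℓ Pm m⊥̸ℓ with m₁ ≟ perpTo ℓ P
  ... | no  m₁≢ = fewer-points-than-perpendiculars Pm₁ m₁⊥ℓ m₁≢ Pm m⊥̸ℓ
  ... | yes m₁≡ = fewer-points-than-perpendiculars Pm₂ m₂⊥ℓ (λ m₂≡ → m₁≢m₂ (trans m₁≡ (sym m₂≡))) Pm m⊥̸ℓ

  module UniformLines (n : ℕ) (line-size : ∀ ℓ → pointsOn G ℓ ≡ n) where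

    -- A line through all v points would give every line all v points,
    -- so x, y, z of (B5) would share the point where x meets y.
    no-full-line : ∀ m → ¬ (∀ Y → I Y m ≡ true)
    no-full-line m full with axB5
    ... | x , y , z , x⊥y , _ , _ , not-concurrent =
          not-concurrent (X , everywhere x X , everywhere y X , everywhere z X)
      where
      X : Fin v
      X = proj₁ (axB2 x y x⊥y)
      n≡v : n ≡ v
      n≡v = begin
        n                          ≡⟨ line-size m ⟨
        count (λ Y → I Y m)        ≡⟨ count-cong full ⟩
        count {v} (λ _ → true)     ≡⟨ count-const v true ⟩
        1 * v                      ≡⟨ *-identityˡ v ⟩
        v                          ∎
        where open ≡-Reasoning
      everywhere : ∀ l Y → I Y l ≡ true
      everywhere l = count-full (λ Y → I Y l) (trans (line-size l) n≡v)

    no-self-perpendicular : ∀ m → (m ⊥ m) ≡ false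
    no-self-perpendicular m with m ⊥ m in m⊥m
    ... | false = refl
    ... | true  = contradiction (self-perpendicular-covers m m⊥m) (no-full-line m)

    perpendicular-count : ∀ m → count (λ l → l ⊥ m) ≡ n
    perpendicular-count m = subst (count (λ l → l ⊥ m) ≡_) (line-size m) (≤-antisym
      (count-mono (perpendiculars↪points m))
      (count-mono (points↪perpendiculars m (no-self-perpendicular m))))

    -- Two distinct perpendiculars to ℓ through P make every line through P
    -- perpendicular to ℓ: otherwise n < n by pencil-bound.
    pencil-perpendicular : ∀ {P ℓ m₁ m₂} → m₁ ≢ m₂ →
                           I P m₁ ≡ true → (m₁ ⊥ ℓ) ≡ true → I P m₂ ≡ true → (m₂ ⊥ ℓ) ≡ true →
                           ∀ m → I P m ≡ true → (m ⊥ ℓ) ≡ true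
    pencil-perpendicular {ℓ = ℓ} m₁≢m₂ Pm₁ m₁⊥ℓ Pm₂ m₂⊥ℓ m Pm with m ⊥ ℓ in m⊥ℓ
    ... | true  = refl
    ... | false = contradiction
          (subst₂ _<_ (line-size m) (perpendicular-count ℓ) (pencil-bound m₁≢m₂ Pm₁ m₁⊥ℓ Pm₂ m₂⊥ℓ Pm m⊥ℓ))
          (n≮n n)

    perpsThrough-many : ∀ {P ℓ} → 2 ≤ perpsThrough G P ℓ → perpsThrough G P ℓ ≡ linesThrough G P
    perpsThrough-many {P} {ℓ} two with count-two (λ m → I P m ∧ (m ⊥ ℓ)) two
    ... | i , j , i≢j , Pi∧i⊥ℓ , Pj∧j⊥ℓ with ∧-split Pi∧i⊥ℓ | ∧-split Pj∧j⊥ℓ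
    ...   | Pi , i⊥ℓ | Pj , j⊥ℓ = count-cong through-P-is-perpendicular
      where
      through-P-is-perpendicular : ∀ m → (I P m ∧ (m ⊥ ℓ)) ≡ I P m
      through-P-is-perpendicular m with I P m in Pm
      ... | false = refl
      ... | true  = pencil-perpendicular i≢j Pi i⊥ℓ Pj j⊥ℓ m Pm

    -- Abstracting over I P ℓ and over the count makes the Boolean test
    -- isPolar? compute in each case.
    perpsThrough-formula : ∀ P ℓ →
      perpsThrough G P ℓ ≡ 1 + indicator (isPolar? G P ℓ) * (linesThrough G P ∸ 1)
    perpsThrough-formula P ℓ with I P ℓ in Pℓ
    ... | true = perpsThrough-on Pℓ
    ... | false with perpsThrough G P ℓ in perps | perpsThrough-positive P ℓ
    ...   | zero        | ()
    ...   | suc zero    | _ = refl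
    ...   | suc (suc k) | _ = begin
      suc (suc k)               ≡⟨ all-lines ⟩
      r                         ≡⟨ m+[n∸m]≡n (subst (1 ≤_) all-lines (s≤s z≤n)) ⟨
      1 + (r ∸ 1)               ≡⟨ cong (1 +_) (*-identityˡ (r ∸ 1)) ⟨
      1 + 1 * (r ∸ 1)           ∎
      where
      open ≡-Reasoning
      r : ℕ
      r = linesThrough G P
      all-lines : suc (suc k) ≡ r
      all-lines = trans (sym perps) (perpsThrough-many (subst (2 ≤_) (sym perps) (s≤s (s≤s z≤n))))

    polar-count : ∀ P → numPolars G P * (linesThrough G P ∸ 1) + b ≡ n * linesThrough G P
    polar-count P = begin
      numPolars G P * (r ∸ 1) + b                           ≡⟨ +-comm _ b ⟩
      b + numPolars G P * (r ∸ 1)                           ≡⟨ sum-one-plus-scaled (isPolar? G P) (r ∸ 1) ⟨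
      sum (λ ℓ → 1 + indicator (isPolar? G P ℓ) * (r ∸ 1))  ≡⟨ sum-cong-≗ (perpsThrough-formula P) ⟨
      sum (λ ℓ → perpsThrough G P ℓ)                        ≡⟨ double-count (I P) _⊥_ ⟩
      sum (λ m → indicator (I P m) * count (m ⊥_))          ≡⟨ sum-cong-≗ (λ m → cong (indicator (I P m) *_) (perpendicular-count′ m)) ⟩
      sum (λ m → indicator (I P m) * n)                     ≡⟨ sum-indicator-scaled (I P) n ⟩
      r * n                                                 ≡⟨ *-comm r n ⟩
      n * r                                                 ∎
      where
      open ≡-Reasoning
      r : ℕ
      r = linesThrough G P
      perpendicular-count′ : ∀ m → count (m ⊥_) ≡ n
      perpendicular-count′ m = trans (count-cong (⊥-comm m)) (perpendicular-count m)

lemma3p18 : (v b : ℕ) (G : Structure v b) → IsPartialSherkPlane G →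
    (Σ (Fin b) λ ℓ → (P : Fin v) → Structure.I G P ℓ ≡ true → Thick G P) →
    (n r : ℕ) →
    ((ℓ : Fin b) → pointsOn G ℓ ≡ n) →
    ((P : Fin v) → linesThrough G P ≡ r) →
    (P : Fin v) → numPolars G P * (r ∸ 1) + b ≡ n * r
lemma3p18 v b G S _ n r line-size point-degree P =
  subst (λ r → numPolars G P * (r ∸ 1) + b ≡ n * r) (point-degree P) (polar-count P)
  where open PartialSherkPlane G S using (module UniformLines)
        open UniformLines n line-size using (polar-count)
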